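{- Let $G$ be a tripartite graph with partition $V_1,V_2,V_3$, with $|V_i|=n_i\geq 1$, and let $d_{i,j}$ denote the edge density between $V_i$ and $V_j$. Suppose $0\leq d_{1,2}\leq d_{1,3}\leq d_{2,3}\leq 1$. Then the number of transversal cliques in $G$ is at most \[ \min\left(d_{1,2},\ \sqrt{d_{1,2}d_{1,3}d_{2,3}}\right)n_1n_2n_3 + o(n_1n_2n_3). \]
   Context: The edge density between $V_i$ and $V_j$ is $e(V_i,V_j)/(|V_i||V_j|)$. A transversal clique is a set of vertices containing exactly one vertex from each part which induces a complete graph (here: a triangle $v_1v_2v_3$ with $v_i\in V_i$). The $o(n_1n_2n_3)$ term is with respect to the $n_i\to\infty$ with the densities fixed. -}

module Defs where

open import Data.Nat using (ℕ; zero; suc)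
import Data.Nat as ℕ
open import Data.Bool using (Bool; true; false; _∧_)
open import Data.Fin using (Fin)
open import Data.List using (map; allFin)
open import Data.Nat.ListAction using (sum)
open import Data.Integer using (+_)
open import Data.Rational using (ℚ; _/_; _+_; _-_; _*_; _≤_; _⊓_)
open import Data.Sum using (_⊎_)
open import Data.Product using (_×_)
open import Relation.Binary.PropositionalEquality using (_≡_)

ℕtoℚ : ℕ → ℚ
ℕtoℚ n = + n / 1

b2n : Bool → ℕ
b2n true = 1
b2n false = 0

count : ∀ {n} → (Fin n → ℕ) → ℕ
count {n} f = sum (map f (allFin n))

-- A tripartite graph with parts V1 = Fin n1, V2 = Fin n2, V3 = Fin n3:
-- all edges go between distinct parts, given by three bipartite adjacency relations.
record TriGraph (n1 n2 n3 : ℕ) : Set where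
  field
    E12 : Fin n1 → Fin n2 → Bool
    E13 : Fin n1 → Fin n3 → Bool
    E23 : Fin n2 → Fin n3 → Bool

open TriGraph public

e12 : ∀ {n1 n2 n3} → TriGraph n1 n2 n3 → ℕ
e12 G = count λ i → count λ j → b2n (E12 G i j)

e13 : ∀ {n1 n2 n3} → TriGraph n1 n2 n3 → ℕ
e13 G = count λ i → count λ k → b2n (E13 G i k)

e23 : ∀ {n1 n2 n3} → TriGraph n1 n2 n3 → ℕ
e23 G = count λ j → count λ k → b2n (E23 G j k)

-- "the edge density between V_i and V_j equals d", i.e. e(V_i,V_j)/(|V_i||V_j|) = d,
-- written multiplicatively (parts are nonempty in the statement).
HasDensity : ℕ → ℕ → ℕ → ℚ → Set
HasDensity e a b d = d * ℕtoℚ (a ℕ.* b) ≡ ℕtoℚ e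

transversalCliques : ∀ {n1 n2 n3} → TriGraph n1 n2 n3 → ℕ
transversalCliques G =
  count λ i → count λ j → count λ k → b2n (E12 G i j ∧ E13 G i k ∧ E23 G j k)

-- x ≤ √y + c   (for y ≥ 0), written without square roots:
-- either x - c ≤ 0, or (x - c)² ≤ y.
LeSqrtPlus : ℚ → ℚ → ℚ → Set
LeSqrtPlus x y c = (x - c ≤ Data.Rational.0ℚ) ⊎ ((x - c) * (x - c) ≤ y)

LeMinSqrtPlus : ℚ → ℚ → ℚ → ℚ → Set
LeMinSqrtPlus x a y c = (x ≤ a + c) × LeSqrtPlus x y c

-- The bound holds exactly, with no error term. Every transversal triangle
-- contains a V₁V₂-edge and a vertex of V₃, so T ≤ e₁₂ n₃. Writing T = Σᵢ Tᵢ over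
-- i ∈ V₁, the triangles at i satisfy Tᵢ ≤ deg₁₂(i) deg₁₃(i) and Tᵢ ≤ e₂₃, hence
-- Tᵢ² ≤ (e₂₃ deg₁₂(i)) deg₁₃(i), and Cauchy–Schwarz gives
-- T² ≤ (Σᵢ e₂₃ deg₁₂(i)) (Σᵢ deg₁₃(i)) = e₁₂ e₁₃ e₂₃. Substituting eᵢⱼ = dᵢⱼ nᵢ nⱼ
-- turns these into T ≤ d₁₂ n₁n₂n₃ and T² ≤ d₁₂d₁₃d₂₃ (n₁n₂n₃)².
module Submission where

open import Defs
open import Data.Nat using (ℕ)
import Data.Nat as ℕ
open import Data.Product using (∃-syntax; _,_)

module CauchySchwarz where

  open import Data.Nat
  open import Data.Nat.Properties
  open import Data.Nat.Tactic.RingSolver using (solve-∀)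
  open import Data.Nat.ListAction using (sum)
  open import Data.List using (List; []; _∷_; map)
  open import Data.Product using (_,_)
  open import Data.Sum using (inj₁; inj₂)
  open import Relation.Binary.PropositionalEquality
  open import Relation.Nullary using (yes; no)
  open import Relation.Nullary.Negation using (contradiction)

  m*m≤n*n⇒m≤n : ∀ m n → m * m ≤ n * n → m ≤ n
  m*m≤n*n⇒m≤n m n m²≤n² with m ≤? n
  ... | yes m≤n = m≤n
  ... | no m≰n = contradiction m²≤n² (<⇒≱ (*-mono-< n<m n<m))
    where n<m = ≰⇒> m≰n

  m≤n⇒4mn≤[m+n]² : ∀ {m n} → m ≤ n → 4 * m * n ≤ (m + n) * (m + n)
  m≤n⇒4mn≤[m+n]² {m} m≤n with m≤n⇒∃[o]m+o≡n m≤n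
  ... | k , refl = subst (4 * m * (m + k) ≤_) (sym (square m k)) (m≤m+n _ (k * k))
    where
    square : ∀ m k → (m + (m + k)) * (m + (m + k)) ≡ 4 * m * (m + k) + k * k
    square = solve-∀

  4mn≤[m+n]² : ∀ m n → 4 * m * n ≤ (m + n) * (m + n)
  4mn≤[m+n]² m n with ≤-total m n
  ... | inj₁ m≤n = m≤n⇒4mn≤[m+n]² m≤n
  ... | inj₂ n≤m = subst₂ _≤_ (swap n m) (cong (λ s → s * s) (+-comm n m)) (m≤n⇒4mn≤[m+n]² n≤m)
    where
    swap : ∀ a b → 4 * a * b ≡ 4 * b * a
    swap = solve-∀

  -- 2xy ≤ 2√(pq·PQ) ≤ pQ + Pq, the last step being AM–GM for pQ and Pq.
  2xy≤pQ+Pq : ∀ x y p P q Q → x * x ≤ p * q → y * y ≤ P * Q → 2 * x * y ≤ p * Q + P * q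
  2xy≤pQ+Pq x y p P q Q x²≤pq y²≤PQ = m*m≤n*n⇒m≤n _ _ (begin
    (2 * x * y) * (2 * x * y)      ≡⟨ regroupˡ x y ⟩
    4 * (x * x) * (y * y)          ≤⟨ *-mono-≤ (*-monoʳ-≤ 4 x²≤pq) y²≤PQ ⟩
    4 * (p * q) * (P * Q)          ≡⟨ regroupʳ p q P Q ⟩
    4 * (p * Q) * (P * q)          ≤⟨ 4mn≤[m+n]² (p * Q) (P * q) ⟩
    (p * Q + P * q) * (p * Q + P * q) ∎)
    where
    open ≤-Reasoning
    regroupˡ : ∀ x y → (2 * x * y) * (2 * x * y) ≡ 4 * (x * x) * (y * y)
    regroupˡ = solve-∀
    regroupʳ : ∀ p q P Q → 4 * (p * q) * (P * Q) ≡ 4 * (p * Q) * (P * q)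
    regroupʳ = solve-∀

  [x+y]²≤[p+P][q+Q] : ∀ x y p P q Q → x * x ≤ p * q → y * y ≤ P * Q →
                      (x + y) * (x + y) ≤ (p + P) * (q + Q)
  [x+y]²≤[p+P][q+Q] x y p P q Q x²≤pq y²≤PQ = begin
    (x + y) * (x + y)               ≡⟨ expandˡ x y ⟩
    x * x + 2 * x * y + y * y       ≤⟨ +-mono-≤ (+-mono-≤ x²≤pq (2xy≤pQ+Pq x y p P q Q x²≤pq y²≤PQ)) y²≤PQ ⟩
    p * q + (p * Q + P * q) + P * Q ≡⟨ expandʳ p q P Q ⟩
    (p + P) * (q + Q)               ∎
    where
    open ≤-Reasoning
    expandˡ : ∀ x y → (x + y) * (x + y) ≡ x * x + 2 * x * y + y * y
    expandˡ = solve-∀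
    expandʳ : ∀ p q P Q → p * q + (p * Q + P * q) + P * Q ≡ (p + P) * (q + Q)
    expandʳ = solve-∀

  cauchy-schwarz : ∀ {A : Set} (x p q : A → ℕ) → (∀ a → x a * x a ≤ p a * q a) → ∀ as →
                   sum (map x as) * sum (map x as) ≤ sum (map p as) * sum (map q as)
  cauchy-schwarz x p q x²≤pq []       = z≤n
  cauchy-schwarz x p q x²≤pq (a ∷ as) =
    [x+y]²≤[p+P][q+Q] (x a) _ (p a) _ (q a) _ (x²≤pq a) (cauchy-schwarz x p q x²≤pq as)

module Counting where

  open import Data.Nat
  open import Data.Nat.Properties
  open import Data.Nat.Tactic.RingSolver using (solve-∀)
  open import Data.Nat.ListAction using (sum)
  open import Data.Bool using (true; false; _∧_)
  open import Data.Fin using (Fin)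
  open import Data.List using (List; []; _∷_; map; allFin; length)
  open import Data.List.Properties using (map-cong; length-tabulate)
  open import Function using (id)
  open import Relation.Binary.PropositionalEquality
  open CauchySchwarz using (cauchy-schwarz)

  module _ {A : Set} where

    sum-map-mono : ∀ {f g : A → ℕ} → (∀ a → f a ≤ g a) → ∀ as → sum (map f as) ≤ sum (map g as)
    sum-map-mono f≤g []       = z≤n
    sum-map-mono f≤g (a ∷ as) = +-mono-≤ (f≤g a) (sum-map-mono f≤g as)

    sum-map-*ˡ : ∀ c (f : A → ℕ) as → sum (map (λ a → c * f a) as) ≡ c * sum (map f as)
    sum-map-*ˡ c f []       = sym (*-zeroʳ c)
    sum-map-*ˡ c f (a ∷ as) = trans (cong (c * f a +_) (sum-map-*ˡ c f as)) (sym (*-distribˡ-+ c (f a) _))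

    sum-map-*ʳ : ∀ c (f : A → ℕ) as → sum (map (λ a → f a * c) as) ≡ sum (map f as) * c
    sum-map-*ʳ c f []       = refl
    sum-map-*ʳ c f (a ∷ as) = trans (cong (f a * c +_) (sum-map-*ʳ c f as)) (sym (*-distribʳ-+ c (f a) _))

    sum-map-const : ∀ c (as : List A) → sum (map (λ _ → c) as) ≡ c * length as
    sum-map-const c []       = sym (*-zeroʳ c)
    sum-map-const c (a ∷ as) = trans (cong (c +_) (sum-map-const c as)) (sym (*-suc c (length as)))

  module _ {n : ℕ} where

    count-cong : ∀ {f g : Fin n → ℕ} → (∀ i → f i ≡ g i) → count f ≡ count g
    count-cong f≗g = cong sum (map-cong f≗g (allFin n))

    count-mono : ∀ {f g : Fin n → ℕ} → (∀ i → f i ≤ g i) → count f ≤ count g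
    count-mono f≤g = sum-map-mono f≤g (allFin n)

    count-*ˡ : ∀ c (f : Fin n → ℕ) → count (λ i → c * f i) ≡ c * count f
    count-*ˡ c f = sum-map-*ˡ c f (allFin n)

    count-*ʳ : ∀ c (f : Fin n → ℕ) → count (λ i → f i * c) ≡ count f * c
    count-*ʳ c f = sum-map-*ʳ c f (allFin n)

    count-const : ∀ c → count {n} (λ _ → c) ≡ c * n
    count-const c = trans (sum-map-const c (allFin n)) (cong (c *_) (length-tabulate id))

    count-cauchy-schwarz : ∀ (x p q : Fin n → ℕ) → (∀ i → x i * x i ≤ p i * q i) →
                           count x * count x ≤ count p * count q
    count-cauchy-schwarz x p q x²≤pq = cauchy-schwarz x p q x²≤pq (allFin n)

  b2n-∧-≤ˡ : ∀ x y → b2n (x ∧ y) ≤ b2n x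
  b2n-∧-≤ˡ true  true  = ≤-refl
  b2n-∧-≤ˡ true  false = z≤n
  b2n-∧-≤ˡ false y     = z≤n

  b2n-∧-≤ʳ : ∀ x y → b2n (x ∧ y) ≤ b2n y
  b2n-∧-≤ʳ true  y = ≤-refl
  b2n-∧-≤ʳ false y = z≤n

  b2n-∧ : ∀ x y → b2n (x ∧ y) ≡ b2n x * b2n y
  b2n-∧ true  y = sym (+-identityʳ (b2n y))
  b2n-∧ false y = refl

  module _ {n1 n2 n3 : ℕ} (G : TriGraph n1 n2 n3) where

    deg12 : Fin n1 → ℕ
    deg12 i = count λ j → b2n (E12 G i j)

    deg13 : Fin n1 → ℕ
    deg13 i = count λ k → b2n (E13 G i k)

    trianglesAt : Fin n1 → ℕ
    trianglesAt i = count λ j → count λ k → b2n (E12 G i j ∧ E13 G i k ∧ E23 G j k)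

    transversalCliques≤e12*n3 : transversalCliques G ≤ e12 G * n3
    transversalCliques≤e12*n3 = begin
      transversalCliques G
        ≤⟨ count-mono (λ i → count-mono λ j → count-mono λ k → b2n-∧-≤ˡ (E12 G i j) (E13 G i k ∧ E23 G j k)) ⟩
      (count λ i → count λ j → count {n3} λ _ → b2n (E12 G i j))
        ≡⟨ count-cong (λ i → count-cong λ j → count-const (b2n (E12 G i j))) ⟩
      (count λ i → count λ j → b2n (E12 G i j) * n3)
        ≡⟨ count-cong (λ i → count-*ʳ n3 λ j → b2n (E12 G i j)) ⟩
      (count λ i → deg12 i * n3)
        ≡⟨ count-*ʳ n3 deg12 ⟩
      e12 G * n3 ∎
      where open ≤-Reasoning

    trianglesAt≤deg12*deg13 : ∀ i → trianglesAt i ≤ deg12 i * deg13 i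
    trianglesAt≤deg12*deg13 i = begin
      trianglesAt i
        ≤⟨ count-mono (λ j → count-mono λ k → ≤-reflexive (b2n-∧ (E12 G i j) (E13 G i k ∧ E23 G j k))) ⟩
      (count λ j → count λ k → b2n (E12 G i j) * b2n (E13 G i k ∧ E23 G j k))
        ≤⟨ count-mono (λ j → count-mono λ k → *-monoʳ-≤ (b2n (E12 G i j)) (b2n-∧-≤ˡ (E13 G i k) (E23 G j k))) ⟩
      (count λ j → count λ k → b2n (E12 G i j) * b2n (E13 G i k))
        ≡⟨ count-cong (λ j → count-*ˡ (b2n (E12 G i j)) λ k → b2n (E13 G i k)) ⟩
      (count λ j → b2n (E12 G i j) * deg13 i)
        ≡⟨ count-*ʳ (deg13 i) (λ j → b2n (E12 G i j)) ⟩
      deg12 i * deg13 i ∎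
      where open ≤-Reasoning

    trianglesAt≤e23 : ∀ i → trianglesAt i ≤ e23 G
    trianglesAt≤e23 i = count-mono λ j → count-mono λ k →
      ≤-trans (b2n-∧-≤ʳ (E12 G i j) (E13 G i k ∧ E23 G j k)) (b2n-∧-≤ʳ (E13 G i k) (E23 G j k))

    trianglesAt² : ∀ i → trianglesAt i * trianglesAt i ≤ (e23 G * deg12 i) * deg13 i
    trianglesAt² i = subst (trianglesAt i * trianglesAt i ≤_) (sym (*-assoc (e23 G) (deg12 i) (deg13 i)))
      (*-mono-≤ (trianglesAt≤e23 i) (trianglesAt≤deg12*deg13 i))

    transversalCliques²≤e12*e13*e23 :
      transversalCliques G * transversalCliques G ≤ e12 G * e13 G * e23 G
    transversalCliques²≤e12*e13*e23 = begin
      count trianglesAt * count trianglesAt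
        ≤⟨ count-cauchy-schwarz trianglesAt (λ i → e23 G * deg12 i) deg13 trianglesAt² ⟩
      (count λ i → e23 G * deg12 i) * e13 G
        ≡⟨ cong (_* e13 G) (count-*ˡ (e23 G) deg12) ⟩
      e23 G * e12 G * e13 G
        ≡⟨ rotate (e23 G) (e12 G) (e13 G) ⟩
      e12 G * e13 G * e23 G ∎
      where
      open ≤-Reasoning
      rotate : ∀ a b c → a * b * c ≡ b * c * a
      rotate = solve-∀

module Embedding where

  open import Data.Integer using (+_)
  import Data.Integer as ℤ
  import Data.Integer.Properties as ℤ
  open import Data.Rational
  open import Data.Rational.Properties
  import Data.Rational.Unnormalised as ℚᵘ
  import Data.Rational.Unnormalised.Properties as ℚᵘ
  open import Relation.Binary.PropositionalEquality

  toℚᵘ-ℕtoℚ : ∀ a → toℚᵘ (ℕtoℚ a) ℚᵘ.≃ ℚᵘ.mkℚᵘ (+ a) 0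
  toℚᵘ-ℕtoℚ a = toℚᵘ-fromℚᵘ (ℚᵘ.mkℚᵘ (+ a) 0)

  ℕtoℚ-* : ∀ a b → ℕtoℚ (a ℕ.* b) ≡ ℕtoℚ a * ℕtoℚ b
  ℕtoℚ-* a b = toℚᵘ-injective (begin
    toℚᵘ (ℕtoℚ (a ℕ.* b))                   ≈⟨ toℚᵘ-ℕtoℚ (a ℕ.* b) ⟩
    ℚᵘ.mkℚᵘ (+ (a ℕ.* b)) 0                 ≈⟨ ℚᵘ.*≡* (cong (ℤ._* + 1) (ℤ.pos-* a b)) ⟩
    ℚᵘ.mkℚᵘ (+ a) 0 ℚᵘ.* ℚᵘ.mkℚᵘ (+ b) 0   ≈⟨ ℚᵘ.*-cong (toℚᵘ-ℕtoℚ a) (toℚᵘ-ℕtoℚ b) ⟨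
    toℚᵘ (ℕtoℚ a) ℚᵘ.* toℚᵘ (ℕtoℚ b)       ≈⟨ toℚᵘ-homo-* (ℕtoℚ a) (ℕtoℚ b) ⟨
    toℚᵘ (ℕtoℚ a * ℕtoℚ b)                 ∎)
    where open ℚᵘ.≃-Reasoning

  ℕtoℚ-*₃ : ∀ a b c → ℕtoℚ (a ℕ.* b ℕ.* c) ≡ ℕtoℚ a * ℕtoℚ b * ℕtoℚ c
  ℕtoℚ-*₃ a b c = trans (ℕtoℚ-* (a ℕ.* b) c) (cong (_* ℕtoℚ c) (ℕtoℚ-* a b))

  ℕtoℚ-mono-≤ : ∀ {a b} → a ℕ.≤ b → ℕtoℚ a ≤ ℕtoℚ b
  ℕtoℚ-mono-≤ {a} {b} a≤b = toℚᵘ-cancel-≤ (begin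
    toℚᵘ (ℕtoℚ a)      ≃⟨ toℚᵘ-ℕtoℚ a ⟩
    ℚᵘ.mkℚᵘ (+ a) 0    ≤⟨ ℚᵘ.*≤* (ℤ.*-monoʳ-≤-nonNeg (+ 1) (ℤ.+≤+ a≤b)) ⟩
    ℚᵘ.mkℚᵘ (+ b) 0    ≃⟨ toℚᵘ-ℕtoℚ b ⟨
    toℚᵘ (ℕtoℚ b)      ∎)
    where open ℚᵘ.≤-Reasoning

  0≤ℕtoℚ : ∀ a → 0ℚ ≤ ℕtoℚ a
  0≤ℕtoℚ a = nonNegative⁻¹ (ℕtoℚ a) {{normalize-nonNeg a 1}}

open import Data.Nat.Tactic.RingSolver using (solve-∀)
open import Data.Rational using (ℚ; 0ℚ; 1ℚ; _≤_; _<_; _+_; _-_; _*_; nonNegative)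
open import Data.Rational.Properties
open import Algebra.Bundles using (CommutativeMonoid)
open import Algebra.Properties.CommutativeSemigroup
  (CommutativeMonoid.commutativeSemigroup *-1-commutativeMonoid) using (interchange)
open import Data.Sum using (inj₁; inj₂)
open import Relation.Binary.PropositionalEquality
open Counting using (transversalCliques≤e12*n3; transversalCliques²≤e12*e13*e23)
open Embedding

p≤p+q : ∀ {p q} → 0ℚ ≤ q → p ≤ p + q
p≤p+q {p} 0≤q = subst (_≤ p + _) (+-identityʳ p) (+-monoʳ-≤ p 0≤q)

p-q≤p : ∀ {p q} → 0ℚ ≤ q → p - q ≤ p
p-q≤p {p} 0≤q = subst (p - _ ≤_) (+-identityʳ p) (+-monoʳ-≤ p (neg-antimono-≤ 0≤q))

0≤p⇒0≤q⇒0≤p*q : ∀ {p q} → 0ℚ ≤ p → 0ℚ ≤ q → 0ℚ ≤ p * q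
0≤p⇒0≤q⇒0≤p*q {p} {q} 0≤p 0≤q =
  nonNegative⁻¹ (p * q) {{nonNeg*nonNeg⇒nonNeg p {{nonNegative 0≤p}} q {{nonNegative 0≤q}}}}

*-mono-≤-nonNeg : ∀ {p q r s} → 0ℚ ≤ p → 0ℚ ≤ r → p ≤ q → r ≤ s → p * r ≤ q * s
*-mono-≤-nonNeg {p} {q} {r} {s} 0≤p 0≤r p≤q r≤s = ≤-trans
  (*-monoʳ-≤-nonNeg r {{nonNegative 0≤r}} p≤q)
  (*-monoˡ-≤-nonNeg q {{nonNegative (≤-trans 0≤p p≤q)}} r≤s)

leMinSqrtPlus : ∀ {x a y c} → 0ℚ ≤ c → x ≤ a → x * x ≤ y → LeMinSqrtPlus x a y c
leMinSqrtPlus {x} {a} {y} {c} 0≤c x≤a x²≤y = ≤-trans x≤a (p≤p+q 0≤c) , leSqrtPlus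
  where
  leSqrtPlus : LeSqrtPlus x y c
  leSqrtPlus with ≤-total (x - c) 0ℚ
  ... | inj₁ x-c≤0 = inj₁ x-c≤0
  ... | inj₂ 0≤x-c = inj₂ (≤-trans (*-mono-≤-nonNeg 0≤x-c 0≤x-c (p-q≤p {x} 0≤c) (p-q≤p {x} 0≤c)) x²≤y)

*-interchange₃ : ∀ x y z a b c → x * y * z * (a * b * c) ≡ (x * a) * (y * b) * (z * c)
*-interchange₃ x y z a b c =
  trans (interchange (x * y) z (a * b) c) (cong (_* (z * c)) (interchange x y a b))

transversalCliques≤d12*n : ∀ {n1 n2 n3} (G : TriGraph n1 n2 n3) d12 → HasDensity (e12 G) n1 n2 d12 →
                           ℕtoℚ (transversalCliques G) ≤ d12 * ℕtoℚ (n1 ℕ.* n2 ℕ.* n3)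
transversalCliques≤d12*n {n1} {n2} {n3} G d12 ρ12 = begin
  ℕtoℚ (transversalCliques G)        ≤⟨ ℕtoℚ-mono-≤ (transversalCliques≤e12*n3 G) ⟩
  ℕtoℚ (e12 G ℕ.* n3)                ≡⟨ ℕtoℚ-* (e12 G) n3 ⟩
  ℕtoℚ (e12 G) * ℕtoℚ n3             ≡⟨ cong (_* ℕtoℚ n3) ρ12 ⟨
  d12 * ℕtoℚ (n1 ℕ.* n2) * ℕtoℚ n3   ≡⟨ *-assoc d12 _ _ ⟩
  d12 * (ℕtoℚ (n1 ℕ.* n2) * ℕtoℚ n3) ≡⟨ cong (d12 *_) (ℕtoℚ-* (n1 ℕ.* n2) n3) ⟨
  d12 * ℕtoℚ (n1 ℕ.* n2 ℕ.* n3)      ∎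
  where open ≤-Reasoning

transversalCliques²≤d12*d13*d23*n² :
  ∀ {n1 n2 n3} (G : TriGraph n1 n2 n3) d12 d13 d23 →
  HasDensity (e12 G) n1 n2 d12 → HasDensity (e13 G) n1 n3 d13 → HasDensity (e23 G) n2 n3 d23 →
  let T = ℕtoℚ (transversalCliques G); n = ℕtoℚ (n1 ℕ.* n2 ℕ.* n3) in
  T * T ≤ d12 * d13 * d23 * n * n
transversalCliques²≤d12*d13*d23*n² {n1} {n2} {n3} G d12 d13 d23 ρ12 ρ13 ρ23 = begin
  ℕtoℚ T * ℕtoℚ T                    ≡⟨ ℕtoℚ-* T T ⟨
  ℕtoℚ (T ℕ.* T)                     ≤⟨ ℕtoℚ-mono-≤ (transversalCliques²≤e12*e13*e23 G) ⟩
  ℕtoℚ (e12 G ℕ.* e13 G ℕ.* e23 G)    ≡⟨ ℕtoℚ-*₃ (e12 G) (e13 G) (e23 G) ⟩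
  ℕtoℚ (e12 G) * ℕtoℚ (e13 G) * ℕtoℚ (e23 G)
    ≡⟨ cong₂ _*_ (cong₂ _*_ ρ12 ρ13) ρ23 ⟨
  d12 * ℕtoℚ (n1 ℕ.* n2) * (d13 * ℕtoℚ (n1 ℕ.* n3)) * (d23 * ℕtoℚ (n2 ℕ.* n3))
    ≡⟨ *-interchange₃ d12 d13 d23 _ _ _ ⟨
  d * (ℕtoℚ (n1 ℕ.* n2) * ℕtoℚ (n1 ℕ.* n3) * ℕtoℚ (n2 ℕ.* n3))
    ≡⟨ cong (d *_) sizes ⟨
  d * (ℕtoℚ n * ℕtoℚ n)              ≡⟨ *-assoc d _ _ ⟨
  d * ℕtoℚ n * ℕtoℚ n                ∎
  where
  open ≤-Reasoning
  T = transversalCliques G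
  n = n1 ℕ.* n2 ℕ.* n3
  d = d12 * d13 * d23
  regroup : ∀ n1 n2 n3 → n1 ℕ.* n2 ℕ.* n3 ℕ.* (n1 ℕ.* n2 ℕ.* n3) ≡ n1 ℕ.* n2 ℕ.* (n1 ℕ.* n3) ℕ.* (n2 ℕ.* n3)
  regroup = solve-∀
  sizes : ℕtoℚ n * ℕtoℚ n ≡ ℕtoℚ (n1 ℕ.* n2) * ℕtoℚ (n1 ℕ.* n3) * ℕtoℚ (n2 ℕ.* n3)
  sizes = begin-equality
    ℕtoℚ n * ℕtoℚ n                                    ≡⟨ ℕtoℚ-* n n ⟨
    ℕtoℚ (n ℕ.* n)                                     ≡⟨ cong ℕtoℚ (regroup n1 n2 n3) ⟩
    ℕtoℚ (n1 ℕ.* n2 ℕ.* (n1 ℕ.* n3) ℕ.* (n2 ℕ.* n3))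
      ≡⟨ ℕtoℚ-*₃ (n1 ℕ.* n2) (n1 ℕ.* n3) (n2 ℕ.* n3) ⟩
    ℕtoℚ (n1 ℕ.* n2) * ℕtoℚ (n1 ℕ.* n3) * ℕtoℚ (n2 ℕ.* n3) ∎

lemma2p1 : (d12 d13 d23 : ℚ) → 0ℚ ≤ d12 → d12 ≤ d13 → d13 ≤ d23 → d23 ≤ 1ℚ →
    (ε : ℚ) → 0ℚ < ε →
    ∃[ N ] ((n1 n2 n3 : ℕ) → 1 ℕ.≤ n1 → 1 ℕ.≤ n2 → 1 ℕ.≤ n3 →
      N ℕ.≤ n1 → N ℕ.≤ n2 → N ℕ.≤ n3 →
      (G : TriGraph n1 n2 n3) →
      HasDensity (e12 G) n1 n2 d12 → HasDensity (e13 G) n1 n3 d13 → HasDensity (e23 G) n2 n3 d23 →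
      LeMinSqrtPlus (ℕtoℚ (transversalCliques G))
        (d12 * ℕtoℚ (n1 ℕ.* n2 ℕ.* n3))
        (d12 * d13 * d23 * ℕtoℚ (n1 ℕ.* n2 ℕ.* n3) * ℕtoℚ (n1 ℕ.* n2 ℕ.* n3))
        (ε * ℕtoℚ (n1 ℕ.* n2 ℕ.* n3)))
lemma2p1 d12 d13 d23 _ _ _ _ ε 0<ε = 0 , λ n1 n2 n3 _ _ _ _ _ _ G ρ12 ρ13 ρ23 →
  leMinSqrtPlus (0≤p⇒0≤q⇒0≤p*q (<⇒≤ 0<ε) (0≤ℕtoℚ (n1 ℕ.* n2 ℕ.* n3)))
    (transversalCliques≤d12*n G d12 ρ12)
    (transversalCliques²≤d12*d13*d23*n² G d12 d13 d23 ρ12 ρ13 ρ23)
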